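{- Let $M$ be a Boolean $n_1\times n_2$ matrix and let $u^{(1)},\dots,u^{(n_3)}\in\{0,1\}^{n_1}$. Let $G^{(0)}$ be the flow graph with start vertex $s$, vertex set $\{s,x_1,\dots,x_{n_3+1},y_1,\dots,y_{n_1},z_1,\dots,z_{n_2}\}$ and edges: $(s,x_1)$ and $(x_t,x_{t+1})$ for $1\le t\le n_3$; $(x_{n_3+1},z_j)$ for $1\le j\le n_2$; $(x_t,y_i)$ for all $1\le t\le n_3$, $1\le i\le n_1$; and $(y_i,z_j)$ if and only if $M_{i,j}=1$. For $1\le t\le n_3$, let $G^{(t)}$ be obtained from $G^{(t-1)}$ by first (if $t\ge 2$) deleting all outgoing edges of $x_{t-1}$ except $(x_{t-1},x_t)$, and then deleting the edge $(x_t,y_i)$ for every $i$ with $u^{(t)}_i=0$. Then for every $1\le t\le n_3$ and every $1\le j\le n_2$, the $j$-th entry of the Boolean product $(u^{(t)})^\intercal M$ equals $1$ if and only if $x_t$ is the immediate dominator of $z_j$ in $G^{(t)}$.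
   Context: In a flow graph with start vertex $s$, $w$ dominates $v$ if every path from $s$ to $v$ contains $w$; the immediate dominator of $v\ne s$ is the dominator of $v$ other than $v$ that is dominated by all other dominators of $v$ other than $v$. The Boolean product $(u^\intercal M)_j$ equals $1$ iff there is $i$ with $u_i=1$ and $M_{i,j}=1$. -}

module Defs where

open import Data.Nat using (ℕ; zero; suc; _+_)
open import Data.Fin using (Fin; toℕ; inject₁; fromℕ)
import Data.Fin as F
open import Data.Bool using (Bool; true; false; _∧_; _∨_)
open import Data.Product using (Σ; _×_; ∃)
open import Data.Sum using (_⊎_)
open import Data.Empty using (⊥)
open import Relation.Nullary using (¬_)
open import Relation.Binary.PropositionalEquality using (_≡_; _≢_)

BMat : ℕ → ℕ → Set
BMat n₁ n₂ = Fin n₁ → Fin n₂ → Bool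

BVec : ℕ → Set
BVec n = Fin n → Bool

⋁ : ∀ {n} → (Fin n → Bool) → Bool
⋁ {zero}  f = false
⋁ {suc n} f = f F.zero ∨ ⋁ (λ i → f (F.suc i))

_ᵀ·_at_ : ∀ {n₁ n₂} → BVec n₁ → BMat n₁ n₂ → Fin n₂ → Bool
(u ᵀ· M at j) = ⋁ (λ i → u i ∧ M i j)

Graph : Set → Set₁
Graph V = V → V → Set

data Path {V : Set} (G : Graph V) : V → V → Set where
  []  : ∀ {a} → Path G a a
  _∷_ : ∀ {a b c} → G a b → Path G b c → Path G a c

data Visits {V : Set} {G : Graph V} (w : V) : ∀ {a b} → Path G a b → Set where
  here  : ∀ {b} {p : Path G w b} → Visits w p
  there : ∀ {a b c} {e : G a b} {p : Path G b c} → Visits w p → Visits w (e ∷ p)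

Dominates : {V : Set} → Graph V → (s w v : V) → Set
Dominates G s w v = ∀ (p : Path G s v) → Visits w p

IDom : {V : Set} → Graph V → (s w v : V) → Set
IDom G s w v =
  w ≢ v × Dominates G s w v
  × (∀ d → Dominates G s d v → d ≢ v → Dominates G s d w)

-- Vertices: s, x₁..x_{n₃+1} (x k ↔ x_{toℕ k + 1}), y₁..y_{n₁}, z₁..z_{n₂}
data Vtx (n₁ n₂ n₃ : ℕ) : Set where
  s : Vtx n₁ n₂ n₃
  x : Fin (suc n₃) → Vtx n₁ n₂ n₃
  y : Fin n₁ → Vtx n₁ n₂ n₃
  z : Fin n₂ → Vtx n₁ n₂ n₃

data Edge₀ {n₁ n₂ n₃ : ℕ} (M : BMat n₁ n₂) : Graph (Vtx n₁ n₂ n₃) where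
  s-x₁ : Edge₀ M s (x F.zero)
  x-x  : (k : Fin n₃) → Edge₀ M (x (inject₁ k)) (x (F.suc k))
  x-z  : (j : Fin n₂) → Edge₀ M (x (fromℕ n₃)) (z j)
  x-y  : (k : Fin n₃) (i : Fin n₁) → Edge₀ M (x (inject₁ k)) (y i)
  y-z  : (i : Fin n₁) (j : Fin n₂) → M i j ≡ true → Edge₀ M (y i) (z j)

-- Edges removed at step t (paper index t ≥ 1); u m is u⁽ᵐ⁺¹⁾
Removed : ∀ {n₁ n₂ n₃} → (Fin n₃ → BVec n₁) → ℕ → Vtx n₁ n₂ n₃ → Vtx n₁ n₂ n₃ → Set
Removed {n₁} {n₂} {n₃} u t (x k) b =
  -- x_{k'} with k' = t - 1 (so t ≥ 2): delete all out-edges except to x_t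
  (toℕ k + 2 ≡ t × ¬ (Σ (Fin (suc n₃)) λ k₂ → b ≡ x k₂ × toℕ k₂ + 1 ≡ t))
  ⊎
  -- x_t: delete (x_t , y_i) whenever u⁽ᵗ⁾_i = 0
  (Σ (Fin n₃) λ m → toℕ m + 1 ≡ t × toℕ k ≡ toℕ m
     × Σ (Fin n₁) λ i → b ≡ y i × u m i ≡ false)
Removed u t _ _ = ⊥

Gr : ∀ {n₁ n₂ n₃} → BMat n₁ n₂ → (Fin n₃ → BVec n₁) → ℕ → Graph (Vtx n₁ n₂ n₃)
Gr M u zero    a b = Edge₀ M a b
Gr M u (suc t) a b = Gr M u t a b × ¬ Removed u (suc t) a b

-- In G⁽ᵗ⁾ the vertices s, x₁, …, x_{t-1} form a chain whose only exits lead forward,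
-- so x_k (k ≤ t) dominates every vertex outside s, x₁, …, x_{k-1}, and every vertex
-- of s, x₁, …, x_t dominates x_t. If u_i = M_ij = 1, the two paths s…x_t y_i z_j and
-- s…x_{n₃+1} z_j meet only in s, x₁, …, x_t and z_j, so every dominator of z_j
-- other than z_j dominates x_t. Otherwise no vertex reachable from s without passing
-- x_{t+1} has an edge to z_j, so x_{t+1} dominates z_j; but x_{t+1} does not
-- dominate x_t, so x_t is not the immediate dominator.
module Submission where

open import Defs
open import Data.Nat using (ℕ; zero; suc; _+_; _≤_; _<_; z≤n; s≤s; s≤s⁻¹)
open import Data.Nat.Properties
  using (≤-refl; ≤-reflexive; ≤-trans; ≤-<-trans; <⇒≤; <⇒≱; ≤⇒≯; <-irrefl; 1+n≰n;
         m<n⇒m<1+n; n<1+n; m≤n⇒m<n∨m≡n; +-comm; +-suc; suc-injective)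
open import Data.Fin using (Fin; toℕ; inject₁; fromℕ)
import Data.Fin as F
open import Data.Fin.Properties using (toℕ-inject₁; toℕ-fromℕ; toℕ-injective; toℕ<n)
open import Data.Fin.Induction using (<-weakInduction)
open import Data.Bool using (Bool; true; false; _∧_; _∨_)
open import Data.Bool.Properties using (∨-zeroʳ; ¬-not; not-¬)
open import Data.Product using (Σ; ∃; _×_; _,_; proj₁; proj₂; map; map₂)
open import Data.Sum using (_⊎_; inj₁; inj₂; [_,_]; map₁)
open import Data.Unit using (⊤; tt)
open import Data.Empty using (⊥; ⊥-elim)
open import Function using (_∘_; id)
open import Function.Bundles using (_⇔_; mk⇔; Equivalence)
open import Relation.Nullary using (¬_)
open import Relation.Binary.PropositionalEquality using (_≡_; _≢_; refl; sym; trans; cong; subst; module ≡-Reasoning)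

open Equivalence using (to; from)

⋁≡true⇔ : ∀ {n} (f : Fin n → Bool) → ⋁ f ≡ true ⇔ ∃ λ i → f i ≡ true
⋁≡true⇔ {zero} f = mk⇔ (λ ()) (λ { (() , _) })
⋁≡true⇔ {suc n} f = mk⇔ there-is-one take-one
  where
  there-is-one : ⋁ f ≡ true → ∃ λ i → f i ≡ true
  there-is-one ⋁f≡true with f F.zero in f₀≡
  ... | true  = F.zero , f₀≡
  ... | false = map F.suc id (to (⋁≡true⇔ (f ∘ F.suc)) ⋁f≡true)
  take-one : ∃ (λ i → f i ≡ true) → ⋁ f ≡ true
  take-one (F.zero , f₀≡true) = cong (_∨ ⋁ (f ∘ F.suc)) f₀≡true
  take-one (F.suc i , fi≡true) =
    trans (cong (f F.zero ∨_) (from (⋁≡true⇔ (f ∘ F.suc)) (i , fi≡true))) (∨-zeroʳ (f F.zero))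

∧≡true⇔ : ∀ {a b} → a ∧ b ≡ true ⇔ (a ≡ true × b ≡ true)
∧≡true⇔ {a} {b} = mk⇔ (split a b) λ { (refl , refl) → refl }
  where
  split : ∀ a b → a ∧ b ≡ true → a ≡ true × b ≡ true
  split true true refl = refl , refl

ᵀ·≡true⇔ : ∀ {n₁ n₂} (u : BVec n₁) (M : BMat n₁ n₂) j →
  (u ᵀ· M at j) ≡ true ⇔ ∃ λ i → u i ≡ true × M i j ≡ true
ᵀ·≡true⇔ u M j =
  mk⇔ (map₂ (to ∧≡true⇔) ∘ to (⋁≡true⇔ λ i → u i ∧ M i j))
      (from (⋁≡true⇔ λ i → u i ∧ M i j) ∘ map₂ (from ∧≡true⇔))

ClosedExcept : {V : Set} → Graph V → (V → Set) → V → Set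
ClosedExcept G P w = ∀ {c d} → G c d → P c → P d ⊎ d ≡ w

module _ {V : Set} {G : Graph V} where

  infixl 5 _∷ʳ_
  _∷ʳ_ : ∀ {a b c} → Path G a b → G b c → Path G a c
  []      ∷ʳ e = e ∷ []
  (e′ ∷ p) ∷ʳ e = e′ ∷ (p ∷ʳ e)

  visits-∷ʳ : ∀ {w a b c} (p : Path G a b) (e : G b c) →
    Visits w (p ∷ʳ e) → Visits w p ⊎ w ≡ c
  visits-∷ʳ []       e here         = inj₁ here
  visits-∷ʳ []       e (there here) = inj₂ refl
  visits-∷ʳ (e′ ∷ p) e here         = inj₁ here
  visits-∷ʳ (e′ ∷ p) e (there v)    = map₁ there (visits-∷ʳ p e v)

  closedExcept⇒dominates : ∀ {P w a b} → ClosedExcept G P w → P a → ¬ P b → Dominates G a w b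
  closedExcept⇒dominates closed Pa ¬Pb [] = ⊥-elim (¬Pb Pa)
  closedExcept⇒dominates closed Pa ¬Pb (e ∷ p) with closed e Pa
  ... | inj₁ Pc   = there (closedExcept⇒dominates closed Pc ¬Pb p)
  ... | inj₂ refl = there here

inject₁<suc : ∀ {n} (k : Fin n) → toℕ (inject₁ k) < suc (toℕ k)
inject₁<suc k = s≤s (≤-reflexive (toℕ-inject₁ k))

not-yet-pruned : ∀ {a t t′} → t ≤ suc a → t′ < t → a + 2 ≢ suc t′
not-yet-pruned {a} t≤1+a t′<t a+2≡1+t′ with suc-injective (trans (sym (+-comm a 2)) a+2≡1+t′)
... | refl = 1+n≰n (≤-trans t′<t t≤1+a)

module _ {n₁ n₂ n₃ : ℕ} (M : BMat n₁ n₂) (u : Fin n₃ → BVec n₁) where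

  private
    Vertex : Set
    Vertex = Vtx n₁ n₂ n₃

  Kept : ℕ → Vertex → Vertex → Set
  Kept t a b = ∀ t′ → t′ < t → ¬ Removed u (suc t′) a b

  Gr⇒Edge₀ : ∀ t {a b} → Gr M u t a b → Edge₀ M a b
  Gr⇒Edge₀ zero    e       = e
  Gr⇒Edge₀ (suc t) (e , _) = Gr⇒Edge₀ t e

  Gr⇒Kept : ∀ t {a b} → Gr M u t a b → Kept t a b
  Gr⇒Kept (suc t) (e , ¬removed) t′ t′<1+t with m≤n⇒m<n∨m≡n (s≤s⁻¹ t′<1+t)
  ... | inj₁ t′<t = Gr⇒Kept t e t′ t′<t
  ... | inj₂ refl = ¬removed

  Edge₀⇒Gr : ∀ t {a b} → Edge₀ M a b → Kept t a b → Gr M u t a b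
  Edge₀⇒Gr zero    e kept = e
  Edge₀⇒Gr (suc t) e kept = Edge₀⇒Gr t e (λ t′ → kept t′ ∘ m<n⇒m<1+n) , kept t (n<1+n t)

  start-edge : ∀ t → Gr M u t s (x F.zero)
  start-edge t = Edge₀⇒Gr t s-x₁ λ _ _ ()

  chain-edge : ∀ t (k : Fin n₃) → Gr M u t (x (inject₁ k)) (x (F.suc k))
  chain-edge t k = Edge₀⇒Gr t (x-x k) kept
    where
    kept : Kept t (x (inject₁ k)) (x (F.suc k))
    kept t′ _ (inj₁ (k+2≡1+t′ , not-to-chain)) = not-to-chain (F.suc k , refl , (begin
      suc (toℕ k) + 1       ≡⟨ sym (+-suc (toℕ k) 1) ⟩
      toℕ k + 2             ≡⟨ cong (_+ 2) (sym (toℕ-inject₁ k)) ⟩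
      toℕ (inject₁ k) + 2   ≡⟨ k+2≡1+t′ ⟩
      suc t′                ∎))
      where open ≡-Reasoning
    kept t′ _ (inj₂ (_ , _ , _ , _ , () , _))

  y-z-edge : ∀ t {i j} → M i j ≡ true → Gr M u t (y i) (z j)
  y-z-edge t {i} {j} Mij≡true = Edge₀⇒Gr t (y-z i j Mij≡true) λ _ _ ()

  last-z-edge : ∀ t j → t ≤ suc n₃ → Gr M u t (x (fromℕ n₃)) (z j)
  last-z-edge t j t≤1+n₃ = Edge₀⇒Gr t (x-z j) kept
    where
    kept : Kept t (x (fromℕ n₃)) (z j)
    kept t′ t′<t (inj₁ (n₃+2≡1+t′ , _)) =
      not-yet-pruned (subst (λ n → t ≤ suc n) (sym (toℕ-fromℕ n₃)) t≤1+n₃) t′<t n₃+2≡1+t′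
    kept t′ _ (inj₂ (_ , _ , _ , _ , () , _))

  s-out : ∀ t {b} → Gr M u t s b → b ≡ x F.zero
  s-out t e with Gr⇒Edge₀ t e
  ... | s-x₁ = refl

  chain-out : ∀ t {k b} → suc (toℕ k) < t → Gr M u t (x k) b →
    ∃ λ k′ → k ≡ inject₁ k′ × b ≡ x (F.suc k′)
  chain-out t {k} 1+k<t e with Gr⇒Edge₀ t e | Gr⇒Kept t e (suc (toℕ k)) 1+k<t
  ... | x-x k′  | _    = k′ , refl , refl
  ... | x-z _   | kept = ⊥-elim (kept (inj₁ (+-comm (toℕ k) 2 , λ { (_ , () , _) })))
  ... | x-y _ _ | kept = ⊥-elim (kept (inj₁ (+-comm (toℕ k) 2 , λ { (_ , () , _) })))

  Before : Fin (suc n₃) → Vertex → Set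
  Before k s      = ⊤
  Before k (x k′) = toℕ k′ < toℕ k
  Before k _      = ⊥

  OnChain : Fin (suc n₃) → Vertex → Set
  OnChain k s      = ⊤
  OnChain k (x k′) = toℕ k′ ≤ toℕ k
  OnChain k _      = ⊥

  before-closed : ∀ t k → toℕ k < t → ClosedExcept (Gr M u t) (Before k) (x k)
  before-closed t k k<t {s} e _ with s-out t e | k
  ... | refl | F.zero  = inj₂ refl
  ... | refl | F.suc _ = inj₁ (s≤s z≤n)
  before-closed t k k<t {x k′} e k′<k with chain-out t (≤-<-trans k′<k k<t) e
  ... | k″ , refl , refl with m≤n⇒m<n∨m≡n (subst (λ n → suc n ≤ toℕ k) (toℕ-inject₁ k″) k′<k)
  ...   | inj₁ 1+k″<k = inj₁ 1+k″<k
  ...   | inj₂ 1+k″≡k = inj₂ (cong x (toℕ-injective 1+k″≡k))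

  x-dominates : ∀ t k {v} → toℕ k < t → ¬ Before k v → Dominates (Gr M u t) s (x k) v
  x-dominates t k k<t = closedExcept⇒dominates (before-closed t k k<t) tt

  onChain⇒dominates : ∀ t k {d} → toℕ k < t → OnChain k d → Dominates (Gr M u t) s d (x k)
  onChain⇒dominates t k {s}    k<t _    _ = here
  onChain⇒dominates t k {x k′} k<t k′≤k   = x-dominates t k′ (≤-<-trans k′≤k k<t) (≤⇒≯ k′≤k)

  ChainPath : ℕ → Fin (suc n₃) → Set
  ChainPath t k = Σ (Path (Gr M u t) s (x k)) λ p → ∀ {w} → Visits w p → OnChain k w

  chain-path : ∀ t k → ChainPath t k
  chain-path t = <-weakInduction (ChainPath t) (start-edge t ∷ [] , λ { here → tt ; (there here) → z≤n }) extend
    where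
    extend : ∀ k → ChainPath t (inject₁ k) → ChainPath t (F.suc k)
    extend k (p , on-chain) =
      p ∷ʳ chain-edge t k , [ on-longer-chain ∘ on-chain , (λ { refl → ≤-refl }) ] ∘ visits-∷ʳ p _
      where
      on-longer-chain : ∀ {w} → OnChain (inject₁ k) w → OnChain (F.suc k) w
      on-longer-chain {s}    _    = tt
      on-longer-chain {x k′} k′≤k = <⇒≤ (≤-<-trans k′≤k (inject₁<suc k))

  next-not-dominates-current : ∀ t k → ¬ Dominates (Gr M u t) s (x (F.suc k)) (x (inject₁ k))
  next-not-dominates-current t k dominates with chain-path t (inject₁ k)
  ... | p , on-chain = <⇒≱ (inject₁<suc k) (on-chain (dominates p))

  module _ (m : Fin n₃) where

    x-y-edge : ∀ t {i} → t ≤ suc (toℕ m) → u m i ≡ true → Gr M u t (x (inject₁ m)) (y i)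
    x-y-edge t {i} t≤1+m uᵢ≡true = Edge₀⇒Gr t (x-y m i) kept
      where
      kept : Kept t (x (inject₁ m)) (y i)
      kept t′ t′<t (inj₁ (m+2≡1+t′ , _)) =
        not-yet-pruned (subst (λ n → t ≤ suc n) (sym (toℕ-inject₁ m)) t≤1+m) t′<t m+2≡1+t′
      kept t′ t′<t (inj₂ (m′ , _ , m≡m′ , _ , refl , uᵢ≡false))
        with toℕ-injective (trans (sym (toℕ-inject₁ m)) m≡m′)
      ... | refl with trans (sym uᵢ≡true) uᵢ≡false
      ... | ()

    -- over-approximates the vertices reachable from s without passing x_{t+1}
    Upstream : Vtx n₁ n₂ n₃ → Set
    Upstream s     = ⊤
    Upstream (x k) = toℕ k ≤ toℕ m
    Upstream (y i) = u m i ≡ true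
    Upstream (z j) = (u m ᵀ· M at j) ≡ true

    current-out : ∀ t {k b} → toℕ m < t → toℕ k ≡ toℕ m → Gr M u t (x k) b →
      Upstream b ⊎ b ≡ x (F.suc m)
    current-out t m<t k≡m e with Gr⇒Edge₀ t e | Gr⇒Kept t e (toℕ m) m<t
    ... | x-x k′ | _ = inj₂ (cong (x ∘ F.suc) (toℕ-injective (trans (sym (toℕ-inject₁ k′)) k≡m)))
    ... | x-z _  | _ = ⊥-elim (<-irrefl (trans (sym k≡m) (toℕ-fromℕ n₃)) (toℕ<n m))
    ... | x-y _ i | kept with u m i in uᵢ≡
    ...   | true  = inj₁ refl
    ...   | false = ⊥-elim (kept (inj₂ (m , +-comm (toℕ m) 1 , k≡m , i , refl , uᵢ≡)))

    upstream-closed : ∀ t → toℕ m < t → ClosedExcept (Gr M u t) Upstream (x (F.suc m))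
    upstream-closed t m<t {s} e _ with s-out t e
    ... | refl = inj₁ z≤n
    upstream-closed t m<t {x k} e k≤m with m≤n⇒m<n∨m≡n k≤m
    ... | inj₂ k≡m = current-out t m<t k≡m e
    ... | inj₁ k<m with chain-out t (≤-<-trans k<m m<t) e
    ...   | k′ , refl , refl = inj₁ (subst (λ n → suc n ≤ toℕ m) (toℕ-inject₁ k′) k<m)
    upstream-closed t m<t {y i} e uᵢ≡true with Gr⇒Edge₀ t e
    ... | y-z _ _ Mij≡true = inj₁ (from (ᵀ·≡true⇔ (u m) M _) (i , uᵢ≡true , Mij≡true))
    upstream-closed t m<t {z _} e _ with Gr⇒Edge₀ t e
    ... | ()

    next-dominates : ∀ t j → toℕ m < t → (u m ᵀ· M at j) ≢ true →
      Dominates (Gr M u t) s (x (F.suc m)) (z j)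
    next-dominates t j m<t = closedExcept⇒dominates (upstream-closed t m<t) tt

    module _ {i j} (uᵢ≡true : u m i ≡ true) (Mij≡true : M i j ≡ true) where

      private
        t : ℕ
        t = suc (toℕ m)

        current-chain : ChainPath t (inject₁ m)
        current-chain = chain-path t (inject₁ m)

        last-chain : ChainPath t (fromℕ n₃)
        last-chain = chain-path t (fromℕ n₃)

        via-current : Path (Gr M u t) s (z j)
        via-current = proj₁ current-chain ∷ʳ x-y-edge t ≤-refl uᵢ≡true ∷ʳ y-z-edge t Mij≡true

        via-last : Path (Gr M u t) s (z j)
        via-last = proj₁ last-chain ∷ʳ last-z-edge t j (s≤s (<⇒≤ (toℕ<n m)))

        not-y-on-last : ¬ Visits (y i) via-last
        not-y-on-last v with visits-∷ʳ (proj₁ last-chain) _ v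
        ... | inj₁ on-chain = proj₂ last-chain on-chain
        ... | inj₂ ()

        common-on-current-chain : ∀ {d} → Visits d via-current → Visits d via-last → d ≢ z j →
          OnChain (inject₁ m) d
        common-on-current-chain v v′ d≢zⱼ with visits-∷ʳ (proj₁ current-chain ∷ʳ _) _ v
        ... | inj₂ refl = ⊥-elim (d≢zⱼ refl)
        ... | inj₁ v″ with visits-∷ʳ (proj₁ current-chain) _ v″
        ...   | inj₁ on-chain = proj₂ current-chain on-chain
        ...   | inj₂ refl     = ⊥-elim (not-y-on-last v′)

      dominator-of-z⇒dominates-current : ∀ {d} → Dominates (Gr M u t) s d (z j) → d ≢ z j →
        Dominates (Gr M u t) s d (x (inject₁ m))
      dominator-of-z⇒dominates-current dominates d≢zⱼ =
        onChain⇒dominates t (inject₁ m) (inject₁<suc m)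
          (common-on-current-chain (dominates via-current) (dominates via-last) d≢zⱼ)

lemma26 : ∀ {n₁ n₂ n₃ : ℕ} (M : BMat n₁ n₂) (u : Fin n₃ → BVec n₁)
    (m : Fin n₃) (j : Fin n₂) →
    ((u m ᵀ· M at j) ≡ true)
      ⇔ IDom (Gr M u (suc (toℕ m))) s (x (inject₁ m)) (z j)
lemma26 M u m j = mk⇔ is-idom product≡true
  where
  is-idom : (u m ᵀ· M at j) ≡ true → IDom (Gr M u (suc (toℕ m))) s (x (inject₁ m)) (z j)
  is-idom product≡true with to (ᵀ·≡true⇔ (u m) M j) product≡true
  ... | i , uᵢ≡true , Mij≡true =
    (λ ()) , x-dominates M u _ (inject₁ m) (inject₁<suc m) (λ ()) ,
    λ _ → dominator-of-z⇒dominates-current M u m uᵢ≡true Mij≡true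

  product≡true : IDom (Gr M u (suc (toℕ m))) s (x (inject₁ m)) (z j) → (u m ᵀ· M at j) ≡ true
  product≡true (_ , _ , dominators-dominate) = ¬-not λ product≡false →
    next-not-dominates-current M u _ m
      (dominators-dominate (x (F.suc m)) (next-dominates M u m _ j (n<1+n _) (not-¬ product≡false)) λ ())
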